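{- Let $\mathcal{F}$ be an SML FSM class with $n$ states and a finite set of child classes, where child class $t$ has $n_t$ states. Suppose that for some children configuration $c$ (with at least one child of each child class) there is a loop of \texttt{move\_to} actions $s_0\to s_1\to\dots\to s_m=s_0$ ($m\ge 1$) of $\mathcal{F}$ under $c$. Then there exist a children configuration $c'$ having exactly $n_t$ children of class $t$ for every child class $t$, and an integer $\ell$ with $1\le \ell\le n$, such that in the Kripke structure $\mathcal{M}$ there is a path of length $\ell$ from $(s_0,c')$ back to $(s_0,c')$ whose $\mathcal{F}$-components are exactly the states among $s_0,\dots,s_{m-1}$ (i.e. the loop is found by considering paths of length at most $n$ in a configuration with $n_t$ children of each class $t$).
   Context: An SML FSM class has a finite set $S$ of states ($|S|=n$). Each state $s\in S$ carries an ordered list of when clauses $(G_1,s_1),\dots,(G_m,s_m)$ with $s_i\in S$, where each guard $G_i$ is a Boolean combination of atomic conditions "$\mathrm{ANY}\ P$ in\_state $T$" or "$\mathrm{ALL}\ P$ in\_state $T$", with $P$ a child class or the literal FwCHILDREN (all children regardless of class) and $T$ a set of states; "ANY $P$ in\_state $T$" holds iff some child matching $P$ is in a state of $T$, "ALL $P$ in\_state $T$" holds iff every child matching $P$ is in a state of $T$. A children configuration consists of a finite collection of children, each with a child class $t$ and a current state among the $n_t$ states of class $t$. Under a fixed configuration $c$ (children states do not change during the when phase), $\mathcal{F}$ in state $s$ performs a \texttt{move\_to} action to $s_i$ where $i$ is the smallest index with $G_i$ true under $c$; if no guard is true, no \texttt{move\_to} is performed. A loop of \texttt{move\_to} actions is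 a nonempty sequence of such actions under a single configuration starting and ending in the same state. The Kripke structure $\mathcal{M}$ has states $(s,c)$ ($s\in S$, $c$ a configuration), all of which are initial, and a transition $(s,c)\to(s',c)$ iff $\mathcal{F}$ in state $s$ under $c$ does a \texttt{move\_to} to $s'$. -}

module Defs where

open import Data.Nat using (ℕ; zero; suc; _≤_)
open import Data.Fin using (Fin; zero; suc; inject₁; fromℕ; _≟_)
open import Data.Fin.Subset using (Subset; _∈_)
open import Data.Fin.Subset.Properties using (_∈?_)
open import Data.Bool using (Bool; true; false; _∧_; _∨_; not; if_then_else_)
open import Data.List using (List; []; _∷_; length; filter)
open import Data.Bool.ListAction using (any; all)
open import Data.Maybe using (Maybe; just; nothing)
open import Data.Product using (Σ; _×_; _,_; proj₁; proj₂; ∃)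
open import Relation.Nullary.Decidable using (⌊_⌋)
open import Relation.Binary.PropositionalEquality using (_≡_)
open import Function.Bundles using (_⇔_)

module _ {k : ℕ} (nt : Fin k → ℕ) where

  Child : Set
  Child = Σ (Fin k) (λ t → Fin (nt t))

  Config : Set
  Config = List Child

  data Pat : Set where
    cls        : Fin k → Pat
    fwChildren : Pat

  -- A state set T: for each class t, a subset of the states of t
  -- (for P = cls t only the component T t is relevant).
  Target : Set
  Target = (t : Fin k) → Subset (nt t)

  data Guard : Set where
    ANY  : Pat → Target → Guard
    ALL  : Pat → Target → Guard
    gAnd : Guard → Guard → Guard
    gOr  : Guard → Guard → Guard
    gNot : Guard → Guard

  matches : Pat → Child → Bool
  matches (cls t') (t , _) = ⌊ t ≟ t' ⌋
  matches fwChildren _     = true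

  inState : Target → Child → Bool
  inState T (t , x) = ⌊ x ∈? T t ⌋

  eval : Config → Guard → Bool
  eval c (ANY P T)  = any (λ ch → matches P ch ∧ inState T ch) c
  eval c (ALL P T)  = all (λ ch → not (matches P ch) ∨ inState T ch) c
  eval c (gAnd g h) = eval c g ∧ eval c h
  eval c (gOr g h)  = eval c g ∨ eval c h
  eval c (gNot g)   = not (eval c g)

  -- An FSM class with n states: each state has an ordered list of when clauses.
  FSM : ℕ → Set
  FSM n = Fin n → List (Guard × Fin n)

  firstTrue : ∀ {n} → Config → List (Guard × Fin n) → Maybe (Fin n)
  firstTrue c []            = nothing
  firstTrue c ((g , s) ∷ w) = if eval c g then just s else firstTrue c w

  moveTo : ∀ {n} → FSM n → Config → Fin n → Maybe (Fin n)
  moveTo F c s = firstTrue c (F s)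

  -- Kripke structure M: states (s , c), all initial; transitions.
  KState : ℕ → Set
  KState n = Fin n × Config

  KTrans : ∀ {n} → FSM n → KState n → KState n → Set
  KTrans F (s , c) (s' , c') = (c' ≡ c) × (moveTo F c s ≡ just s')

  IsKPath : ∀ {n} → FSM n → (ℓ : ℕ) → (Fin (suc ℓ) → KState n) → Set
  IsKPath F ℓ ps = (i : Fin ℓ) → KTrans F (ps (inject₁ i)) (ps (suc i))

  IsMoveSeq : ∀ {n} → FSM n → Config → (m : ℕ) → (Fin (suc m) → Fin n) → Set
  IsMoveSeq F c m ss = (i : Fin m) → moveTo F c (ss (inject₁ i)) ≡ just (ss (suc i))

  count : Config → Fin k → ℕ
  count c t = length (filter (λ ch → proj₁ ch ≟ t) c)

  AllClassesPresent : Config → Set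
  AllClassesPresent c = (t : Fin k) → 1 ≤ count c t

module Submission where

open import Defs
open import Data.Nat using (ℕ; suc; _≤_)
open import Data.Fin using (Fin; zero; inject₁; fromℕ)
open import Data.Product using (Σ; _×_; _,_; proj₁; ∃)
open import Relation.Binary.PropositionalEquality using (_≡_)
open import Function.Bundles using (_⇔_)

open import Data.Nat using (zero; _<_; _+_; _*_; _∸_; _<?_; _≤?_)
open import Data.Nat.Properties
  using (≤-refl; ≤-trans; <⇒≤; <-≤-trans; ≤-antisym; ≰⇒>; ≮⇒≥; +-monoʳ-<; m≤m+n; m<n⇒0<n∸m; m∸n+n≡m; *-identityˡ)
open import Data.Nat.Induction using (<-rec)
open import Data.Fin using (suc; toℕ; fromℕ<) renaming (_≟_ to _≟ᶠ_)
open import Data.Fin.Properties using (toℕ<n; toℕ-fromℕ; toℕ-fromℕ<; fromℕ<-toℕ; toℕ-inject₁; pigeonhole)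
open import Data.Product using (proj₂)
open import Data.Product.Properties using (≡-dec)
open import Data.Bool using (Bool; true; false; T; _∧_; _∨_; not)
open import Data.List using (List; []; _∷_; _++_; map; concatMap; length; filter; allFin)
open import Data.List.Properties using (length-tabulate; filter-accept; filter-reject; filter-none)
open import Data.List.Relation.Unary.All as All using (All)
open import Data.List.Relation.Unary.All.Properties using (all-anti-mono)
open import Data.List.Relation.Unary.AllPairs using (_∷_)
open import Data.List.Relation.Unary.Unique.Propositional using (Unique)
open import Data.List.Relation.Unary.Unique.Propositional.Properties using (allFin⁺)
open import Data.List.Relation.Unary.Any using (here; there)
open import Data.List.Relation.Binary.Subset.Propositional using (_⊆_)
open import Data.List.Relation.Binary.Subset.Propositional.Properties using (any⁺)
open import Data.List.Membership.Propositional using (_∈_; lose; find)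
open import Data.List.Membership.Propositional.Properties
  using (∈-allFin; ∈-map⁺; ∈-map⁻; ∈-concatMap⁺; ∈-concatMap⁻)
import Data.List.Membership.DecPropositional as DecMembership
open import Data.Maybe using (Maybe; just)
open import Data.Maybe.Properties using (just-injective)
open import Relation.Binary.Definitions using (DecidableEquality)
open import Relation.Binary.PropositionalEquality using (refl; sym; trans; cong; cong₂; subst; module ≡-Reasoning)
open import Relation.Nullary using (Dec; yes; no; ¬_)
open import Relation.Nullary.Negation using (contradiction)
open import Function.Base using (_∘_)
open import Function.Bundles using (mk⇔)
open import Function.Properties.Equivalence using () renaming (trans to ⇔-trans; sym to ⇔-sym)

-- The proof separates the children configuration from the state sequence.
--
-- A guard only asks whether some/all children lie in given
-- states, so its value depends on the set of children present, not on their
-- multiplicities (SameMembers).  If every class occurs in c, we "saturate" c: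
-- for each class t and each state y of t take the child (t , y) if it occurs
-- in c, and a copy of some child of class t in c otherwise.  The resulting
-- configuration c′ has exactly nt t children of class t (count-saturated) and
-- the same members as c, hence the same move_to function (Saturation).
--
-- A move_to sequence is a walk of the deterministic partial map
-- s ↦ moveTo F c s (Walk, extend-walk).  If a walk returns to its start at a
-- time j > n, two of its first n+1 positions coincide (pigeonhole), and by
-- determinism it already returns earlier (earlier-return); so it returns at
-- some time ℓ with 1 ≤ ℓ ≤ n (short-return).  The first ℓ positions form a
-- cycle visiting exactly the states of the original loop (cycle-visits), and
-- read under the constant configuration c′ they form a path of the Kripke
-- structure (walk⇒path).

T-ext : ∀ {a b : Bool} → (T a → T b) → (T b → T a) → a ≡ b
T-ext {false} {false} _ _ = refl
T-ext {false} {true}  _ g = contradiction (g _) λ ()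
T-ext {true}  {false} f _ = contradiction (f _) λ ()
T-ext {true}  {true}  _ _ = refl

occurs-once : ∀ {A : Set} (_≟_ : DecidableEquality A) {xs : List A} {x : A} →
  Unique xs → x ∈ xs → length (filter (_≟ x) xs) ≡ 1
occurs-once _≟_ {y ∷ xs} {x} (y∉xs ∷ _) (here refl)
  rewrite filter-accept (_≟ x) {x} {xs} refl
        | filter-none (_≟ x) (All.map (λ x≢z z≡x → x≢z (sym z≡x)) y∉xs) = refl
occurs-once _≟_ {y ∷ xs} {x} (y∉xs ∷ unique) (there x∈xs)
  rewrite filter-reject (_≟ x) {y} {xs} (All.lookup y∉xs x∈xs) = occurs-once _≟_ unique x∈xs

module _ {k : ℕ} (nt : Fin k → ℕ) where

  module SameMembers {c₁ c₂ : Config nt} (c₁⊆c₂ : c₁ ⊆ c₂) (c₂⊆c₁ : c₂ ⊆ c₁) where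

    eval-same : (g : Guard nt) → eval nt c₁ g ≡ eval nt c₂ g
    eval-same (ANY P S)  = T-ext (any⁺ _ c₁⊆c₂) (any⁺ _ c₂⊆c₁)
    eval-same (ALL P S)  = T-ext (all-anti-mono _ c₂⊆c₁) (all-anti-mono _ c₁⊆c₂)
    eval-same (gAnd g h) = cong₂ _∧_ (eval-same g) (eval-same h)
    eval-same (gOr g h)  = cong₂ _∨_ (eval-same g) (eval-same h)
    eval-same (gNot g)   = cong not (eval-same g)

    firstTrue-same : ∀ {n} (whens : List (Guard nt × Fin n)) →
      firstTrue nt c₁ whens ≡ firstTrue nt c₂ whens
    firstTrue-same [] = refl
    firstTrue-same ((g , _) ∷ whens) rewrite eval-same g | firstTrue-same whens = refl

    moveTo-same : ∀ {n} (F : FSM nt n) (s : Fin n) → moveTo nt F c₁ s ≡ moveTo nt F c₂ s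
    moveTo-same F s = firstTrue-same (F s)

  count-++ : (c₁ c₂ : Config nt) (t : Fin k) → count nt (c₁ ++ c₂) t ≡ count nt c₁ t + count nt c₂ t
  count-++ [] c₂ t = refl
  count-++ ((u , _) ∷ c₁) c₂ t with u ≟ᶠ t
  ... | yes _ = cong suc (count-++ c₁ c₂ t)
  ... | no _  = count-++ c₁ c₂ t

  count-own-class : ∀ {A : Set} (u t : Fin k) → u ≡ t → (f : A → Fin (nt u)) (ys : List A) →
    count nt (map (λ y → u , f y) ys) t ≡ length ys
  count-own-class u t u≡t f [] = refl
  count-own-class u t u≡t f (y ∷ ys) with u ≟ᶠ t
  ... | yes _   = cong suc (count-own-class u t u≡t f ys)
  ... | no u≢t  = contradiction u≡t u≢t

  count-other-class : ∀ {A : Set} (u t : Fin k) → ¬ u ≡ t → (f : A → Fin (nt u)) (ys : List A) →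
    count nt (map (λ y → u , f y) ys) t ≡ 0
  count-other-class u t u≢t f [] = refl
  count-other-class u t u≢t f (y ∷ ys) with u ≟ᶠ t
  ... | yes u≡t = contradiction u≡t u≢t
  ... | no _    = count-other-class u t u≢t f ys

  member-of-class : (c : Config nt) (t : Fin k) → 1 ≤ count nt c t → ∃ λ x → (t , x) ∈ c
  member-of-class ((u , x) ∷ c) t present with u ≟ᶠ t
  ... | yes refl = x , here refl
  ... | no _     = let (y , y∈c) = member-of-class c t present in y , there y∈c

  module Saturation (c : Config nt) (present : AllClassesPresent nt c) where

    open DecMembership (≡-dec _≟ᶠ_ (λ {t} → _≟ᶠ_ {nt t})) using (_∈?_)

    slot : (t : Fin k) (y : Fin (nt t)) → Σ (Fin (nt t)) λ z → (t , z) ∈ c × ((t , y) ∈ c → z ≡ y)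
    slot t y with (t , y) ∈? c
    ... | yes ty∈c = y , ty∈c , λ _ → refl
    ... | no  ty∉c = let (x , tx∈c) = member-of-class c t (present t) in
                     x , tx∈c , λ ty∈c → contradiction ty∈c ty∉c

    block : Fin k → Config nt
    block t = map (λ y → t , proj₁ (slot t y)) (allFin (nt t))

    saturated : Config nt
    saturated = concatMap block (allFin k)

    saturated⊆c : saturated ⊆ c
    saturated⊆c ch∈sat =
      let t , _ , ch∈block = find (∈-concatMap⁻ block {xs = allFin k} ch∈sat)
          y , _ , ch≡ty    = ∈-map⁻ _ ch∈block
      in subst (_∈ c) (sym ch≡ty) (proj₁ (proj₂ (slot t y)))

    c⊆saturated : c ⊆ saturated
    c⊆saturated {t , y} ty∈c = ∈-concatMap⁺ block (lose (∈-allFin t) ty∈block)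
      where
      ty∈block : (t , y) ∈ block t
      ty∈block = subst (λ z → (t , z) ∈ block t) (proj₂ (proj₂ (slot t y)) ty∈c)
                   (∈-map⁺ _ (∈-allFin y))

    count-blocks : (us : List (Fin k)) (t : Fin k) →
      count nt (concatMap block us) t ≡ length (filter (_≟ᶠ t) us) * nt t
    count-blocks [] t = refl
    count-blocks (u ∷ us) t = trans (count-++ (block u) (concatMap block us) t) (step (u ≟ᶠ t))
      where
      step : Dec (u ≡ t) → count nt (block u) t + count nt (concatMap block us) t
                           ≡ length (filter (_≟ᶠ t) (u ∷ us)) * nt t
      step (yes u≡t) = trans
        (cong₂ _+_ (trans (count-own-class u t u≡t _ (allFin (nt u)))
                          (trans (length-tabulate (λ y → y)) (cong nt u≡t)))
                   (count-blocks us t))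
        (cong (λ ts → length ts * nt t) (sym (filter-accept (_≟ᶠ t) u≡t)))
      step (no u≢t) = trans
        (cong₂ _+_ (count-other-class u t u≢t _ (allFin (nt u))) (count-blocks us t))
        (cong (λ ts → length ts * nt t) (sym (filter-reject (_≟ᶠ t) u≢t)))

    count-saturated : (t : Fin k) → count nt saturated t ≡ nt t
    count-saturated t = begin
      count nt saturated t                            ≡⟨ count-blocks (allFin k) t ⟩
      length (filter (_≟ᶠ t) (allFin k)) * nt t       ≡⟨ cong (_* nt t) (occurs-once _≟ᶠ_ (allFin⁺ k) (∈-allFin t)) ⟩
      1 * nt t                                        ≡⟨ *-identityˡ (nt t) ⟩
      nt t                                            ∎
      where open ≡-Reasoning

Walk : {A : Set} → (A → Maybe A) → ℕ → (ℕ → A) → Set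
Walk g m w = ∀ i → i < m → g (w i) ≡ just (w (suc i))

-- A finite sequence s₀ … s_m, extended to ℕ (constantly s₀ beyond m); a
-- sequence of g-steps becomes a walk of g.
module _ {A : Set} {m : ℕ} (ss : Fin (suc m) → A) where

  extend : ℕ → A
  extend i with i <? suc m
  ... | yes i<1+m = ss (fromℕ< i<1+m)
  ... | no  _     = ss zero

  extend-toℕ : (j : Fin (suc m)) → extend (toℕ j) ≡ ss j
  extend-toℕ j with toℕ j <? suc m
  ... | yes j<1+m = cong ss (fromℕ<-toℕ j j<1+m)
  ... | no  j≮1+m = contradiction (toℕ<n j) j≮1+m

  extend-walk : {g : A → Maybe A} → ((j : Fin m) → g (ss (inject₁ j)) ≡ just (ss (suc j))) →
    Walk g m extend
  extend-walk {g} moves i i<m =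
    subst (λ i → g (extend i) ≡ just (extend (suc i))) (toℕ-fromℕ< i<m) (move-at (fromℕ< i<m))
    where
    move-at : (j : Fin m) → g (extend (toℕ j)) ≡ just (extend (suc (toℕ j)))
    move-at j = begin
      g (extend (toℕ j))           ≡⟨ cong (g ∘ extend) (sym (toℕ-inject₁ j)) ⟩
      g (extend (toℕ (inject₁ j))) ≡⟨ cong g (extend-toℕ (inject₁ j)) ⟩
      g (ss (inject₁ j))           ≡⟨ moves j ⟩
      just (ss (suc j))            ≡⟨ cong just (sym (extend-toℕ (suc j))) ⟩
      just (extend (suc (toℕ j)))  ∎
      where open ≡-Reasoning

module Walks {A : Set} (g : A → Maybe A) {m : ℕ} (w : ℕ → A) (walk : Walk g m w) where

  walk-next : ∀ {i j} → i < m → j < m → w i ≡ w j → w (suc i) ≡ w (suc j)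
  walk-next {i} {j} i<m j<m wi≡wj =
    just-injective (trans (sym (walk i i<m)) (trans (cong g wi≡wj) (walk j j<m)))

  walk-shift : ∀ d {i j} → d + i ≤ m → d + j ≤ m → w i ≡ w j → w (d + i) ≡ w (d + j)
  walk-shift zero    _   _   wi≡wj = wi≡wj
  walk-shift (suc d) d+i<m d+j<m wi≡wj =
    walk-next d+i<m d+j<m (walk-shift d (<⇒≤ d+i<m) (<⇒≤ d+j<m) wi≡wj)

  Returns : ℕ → Set
  Returns j = (1 ≤ j) × (j ≤ m) × (w j ≡ w 0)

  -- Up to a return at time ℓ, the successor of a position w r (r < ℓ) is
  -- again such a position: w (r+1), or w 0 when r+1 = ℓ.
  cycle-successor : ∀ {ℓ r} → Returns ℓ → r < ℓ → ∃ λ r′ → r′ < ℓ × w (suc r) ≡ w r′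
  cycle-successor {ℓ} {r} (1≤ℓ , _ , wℓ≡w0) r<ℓ with suc r <? ℓ
  ... | yes 1+r<ℓ = suc r , 1+r<ℓ , refl
  ... | no  1+r≮ℓ = 0 , 1≤ℓ , trans (cong w (≤-antisym r<ℓ (≮⇒≥ 1+r≮ℓ))) wℓ≡w0

  within-cycle : ∀ {ℓ} → Returns ℓ → ∀ i → i ≤ m → ∃ λ r → r < ℓ × w i ≡ w r
  within-cycle (1≤ℓ , _ , _) zero _ = 0 , 1≤ℓ , refl
  within-cycle ret@(_ , ℓ≤m , _) (suc i) i<m =
    let r , r<ℓ , wi≡wr    = within-cycle ret i (<⇒≤ i<m)
        r′ , r′<ℓ , wr+1≡wr′ = cycle-successor ret r<ℓ
    in r′ , r′<ℓ , trans (walk-next i<m (<-≤-trans r<ℓ ℓ≤m) wi≡wr) wr+1≡wr′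

  cycle-visits : ∀ {ℓ} → Returns ℓ → (x : A) →
    (∃ λ i → i < ℓ × w i ≡ x) ⇔ (∃ λ j → j < m × w j ≡ x)
  cycle-visits ret@(_ , ℓ≤m , _) x = mk⇔
    (λ (i , i<ℓ , wi≡x) → i , <-≤-trans i<ℓ ℓ≤m , wi≡x)
    (λ (j , j<m , wj≡x) → let r , r<ℓ , wj≡wr = within-cycle ret j (<⇒≤ j<m)
                          in r , r<ℓ , trans (sym wj≡wr) wj≡x)

module FiniteWalks {n : ℕ} (g : Fin n → Maybe (Fin n)) {m : ℕ} (w : ℕ → Fin n) (walk : Walk g m w) where

  open Walks g w walk

  -- A return at a time j > n can be shortened: two of w 0 … w (j-1) coincide,
  -- say w a ≡ w b with a < b < j, and then w (j - b + a) ≡ w j ≡ w 0.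
  earlier-return : ∀ {j} → Returns j → n < j → ∃ λ j′ → j′ < j × Returns j′
  earlier-return {j} (_ , j≤m , wj≡w0) n<j
    with a , b , a<b , wa≡wb ← pigeonhole n<j (λ i → w (toℕ i)) =
    d + toℕ a , shorter , ≤-trans (m<n⇒0<n∸m b<j) (m≤m+n d (toℕ a)) , <⇒≤ (<-≤-trans shorter j≤m) ,
    trans back-at-j wj≡w0
    where
    b<j : toℕ b < j
    b<j = toℕ<n b
    d = j ∸ toℕ b
    d+b≡j : d + toℕ b ≡ j
    d+b≡j = m∸n+n≡m (<⇒≤ b<j)
    shorter : d + toℕ a < j
    shorter = subst (d + toℕ a <_) d+b≡j (+-monoʳ-< d a<b)
    back-at-j : w (d + toℕ a) ≡ w j
    back-at-j = trans (walk-shift d (<⇒≤ (<-≤-trans shorter j≤m)) (subst (_≤ m) (sym d+b≡j) j≤m) wa≡wb)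
                      (cong w d+b≡j)

  short-return : ∀ {j} → Returns j → ∃ λ ℓ → Returns ℓ × ℓ ≤ n
  short-return = <-rec (λ j → Returns j → ∃ λ ℓ → Returns ℓ × ℓ ≤ n) shorten _
    where
    shorten : ∀ j → (∀ {j′} → j′ < j → Returns j′ → ∃ λ ℓ → Returns ℓ × ℓ ≤ n) →
      Returns j → ∃ λ ℓ → Returns ℓ × ℓ ≤ n
    shorten j rec ret with j ≤? n
    ... | yes j≤n = j , ret , j≤n
    ... | no  j≰n = let j′ , j′<j , ret′ = earlier-return ret (≰⇒> j≰n) in rec j′<j ret′

first-entries : ∀ {A : Set} {ℓ : ℕ} (f : Fin (suc ℓ) → A) (w : ℕ → A) →
  ((j : Fin (suc ℓ)) → f j ≡ w (toℕ j)) → (x : A) →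
  (∃ λ (i : Fin ℓ) → f (inject₁ i) ≡ x) ⇔ (∃ λ i → i < ℓ × w i ≡ x)
first-entries f w agree x = mk⇔
  (λ (i , fi≡x) → toℕ i , toℕ<n i ,
     trans (cong w (sym (toℕ-inject₁ i))) (trans (sym (agree (inject₁ i))) fi≡x))
  (λ (i , i<ℓ , wi≡x) → fromℕ< i<ℓ ,
     trans (agree (inject₁ (fromℕ< i<ℓ)))
           (trans (cong w (trans (toℕ-inject₁ (fromℕ< i<ℓ)) (toℕ-fromℕ< i<ℓ))) wi≡x))

walk⇒path : ∀ {k} {nt : Fin k → ℕ} {n} (F : FSM nt n) (c : Config nt) {ℓ : ℕ} {w : ℕ → Fin n} →
  Walk (moveTo nt F c) ℓ w → IsKPath nt F ℓ (λ i → w (toℕ i) , c)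
walk⇒path F c walk i rewrite toℕ-inject₁ i = refl , walk (toℕ i) (toℕ<n i)

theorem1 : {k : ℕ} (nt : Fin k → ℕ) (n : ℕ) (F : FSM nt n)
  (c : Config nt) → AllClassesPresent nt c →
  (m : ℕ) → 1 ≤ m → (ss : Fin (suc m) → Fin n) →
  IsMoveSeq nt F c m ss → ss (fromℕ m) ≡ ss zero →
  Σ (Config nt) λ c' → ((t : Fin k) → count nt c' t ≡ nt t) ×
    Σ ℕ λ ℓ → (1 ≤ ℓ) × (ℓ ≤ n) ×
      Σ (Fin (suc ℓ) → KState nt n) λ ps →
        IsKPath nt F ℓ ps × (ps zero ≡ (ss zero , c')) × (ps (fromℕ ℓ) ≡ (ss zero , c')) ×
        ((x : Fin n) → (∃ λ (i : Fin ℓ) → proj₁ (ps (inject₁ i)) ≡ x) ⇔ (∃ λ (j : Fin m) → ss (inject₁ j) ≡ x))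
theorem1 nt n F c present m 1≤m ss moves loop =
  let ℓ , ret , ℓ≤n = short-return returns-at-m
  in c′ , count-saturated , ℓ , proj₁ ret , ℓ≤n , kpath ℓ , walk⇒path F c′ (walk-under-c′ ret) ,
     cong (_, c′) w0≡s0 , back-at-start ret , same-visits ret
  where
  open Saturation nt c present renaming (saturated to c′)
  open SameMembers nt saturated⊆c c⊆saturated using (moveTo-same)
  w : ℕ → Fin n
  w = extend ss
  walk : Walk (moveTo nt F c) m w
  walk = extend-walk ss {moveTo nt F c} moves
  open Walks (moveTo nt F c) w walk
  open FiniteWalks (moveTo nt F c) w walk using (short-return)
  w0≡s0 : w 0 ≡ ss zero
  w0≡s0 = extend-toℕ ss zero
  returns-at-m : Returns m
  returns-at-m = 1≤m , ≤-refl ,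
    trans (cong w (sym (toℕ-fromℕ m))) (trans (extend-toℕ ss (fromℕ m)) (trans loop (sym w0≡s0)))
  kpath : (ℓ : ℕ) → Fin (suc ℓ) → KState nt n
  kpath ℓ i = w (toℕ i) , c′
  walk-under-c′ : ∀ {ℓ} → Returns ℓ → Walk (moveTo nt F c′) ℓ w
  walk-under-c′ (_ , ℓ≤m , _) i i<ℓ = trans (moveTo-same F (w i)) (walk i (<-≤-trans i<ℓ ℓ≤m))
  back-at-start : ∀ {ℓ} → Returns ℓ → kpath ℓ (fromℕ ℓ) ≡ (ss zero , c′)
  back-at-start {ℓ} (_ , _ , wℓ≡w0) = cong (_, c′) (trans (cong w (toℕ-fromℕ ℓ)) (trans wℓ≡w0 w0≡s0))
  same-visits : ∀ {ℓ} → Returns ℓ → (x : Fin n) →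
    (∃ λ (i : Fin ℓ) → proj₁ (kpath ℓ (inject₁ i)) ≡ x) ⇔ (∃ λ (j : Fin m) → ss (inject₁ j) ≡ x)
  same-visits {ℓ} ret x =
    ⇔-trans (first-entries (proj₁ ∘ kpath ℓ) w (λ _ → refl) x)
      (⇔-trans (cycle-visits ret x) (⇔-sym (first-entries ss w (sym ∘ extend-toℕ ss) x)))
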